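{- Let $M\subseteq\{\pm e_1,\dots,\pm e_n\}\subset\mathbb R^n$. Then $M$ satisfies the strong exchange property with respect to the root system $D_n$ if and only if $\nu_M$ satisfies the tropical equation $f^{(D)}_{\lozenge_n}=\bigoplus_{i=1}^n x_i\odot x_{ -i}$.
   Context: The root system $D_n$ is $\{\pm e_i\pm e_j: i\ne j\}$ with Weyl group $W(D_n)$; $\{\pm e_1,\dots,\pm e_n\}$ is the $W(D_n)$-orbit of $-e_1$ (these are the cosets $W(D_n)/W(D_{n-1})$ for the maximal parabolic omitting the first simple reflection), whose convex hull is the cross polytope. $M$ satisfies the strong exchange property (is a strong Coxeter matroid) if for any distinct $p,q\in M$ there is a root $\alpha$ whose hyperplane $\alpha^\perp$ separates $p$ and $q$ with $s_\alpha p,s_\alpha q\in M$ ($s_\alpha$ the reflection in $\alpha^\perp$). Variables $x_{\pm i}$ correspond to $\pm e_i$; $\nu_M(x_{\pm i})=1$ iff $\pm e_i\in M$. The tropical equation is satisfied if the number of $i$ with both $e_i,-e_i\in M$ is not exactly one. -}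

module Defs where

open import Data.Bool using (Bool; true; false; _∧_; if_then_else_)
open import Data.Nat using (ℕ)
import Data.Nat as ℕ
open import Data.Fin using (Fin; zero; suc; _≟_)
open import Data.Integer using (ℤ; +_; -_; _+_; _-_; _*_; _<_)
open import Data.Product using (Σ; ∃; _×_; _,_)
open import Data.Sum using (_⊎_)
open import Relation.Nullary using (¬_; does)
open import Relation.Binary.PropositionalEquality using (_≡_; _≢_)

-- Vectors in ℤⁿ ⊂ ℝⁿ (all points and roots involved have integer coordinates).
Vecℤ : ℕ → Set
Vecℤ n = Fin n → ℤ

sumFin : ∀ {n} → (Fin n → ℤ) → ℤ
sumFin {ℕ.zero}  f = + 0
sumFin {ℕ.suc n} f = f zero + sumFin (λ k → f (suc k))

sumFinℕ : ∀ {n} → (Fin n → ℕ) → ℕ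
sumFinℕ {ℕ.zero}  f = 0
sumFinℕ {ℕ.suc n} f = f zero ℕ.+ sumFinℕ (λ k → f (suc k))

dot : ∀ {n} → Vecℤ n → Vecℤ n → ℤ
dot u v = sumFin (λ k → u k * v k)

sgn : Bool → ℤ
sgn true  = + 1
sgn false = - (+ 1)

basis : ∀ {n} → Fin n → Vecℤ n
basis i k = if does (i ≟ k) then + 1 else + 0

-- The points ±e_i: (true , i) ↦ e_i, (false , i) ↦ -e_i.
-- These also index the variables x_{±i}.
SignedIdx : ℕ → Set
SignedIdx n = Bool × Fin n

pt : ∀ {n} → SignedIdx n → Vecℤ n
pt (s , i) k = sgn s * basis i k

record RootD (n : ℕ) : Set where
  constructor root
  field
    σ   : Bool
    τ   : Bool
    i   : Fin n
    j   : Fin n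
    i≢j : i ≢ j

rootVec : ∀ {n} → RootD n → Vecℤ n
rootVec (root σ τ i j _) k = sgn σ * basis i k + sgn τ * basis j k

-- Reflection in α^⊥:  s_α v = v - (2⟨α,v⟩/⟨α,α⟩) α = v - ⟨α,v⟩ α  (since ⟨α,α⟩ = 2).
reflect : ∀ {n} → RootD n → Vecℤ n → Vecℤ n
reflect α v k = v k - dot (rootVec α) v * rootVec α k

Subset± : ℕ → Set
Subset± n = SignedIdx n → Bool

_∈M_ : ∀ {n} → Vecℤ n → Subset± n → Set
v ∈M M = Σ _ λ p → M p ≡ true × (∀ k → pt p k ≡ v k)

Separates : ∀ {n} → RootD n → Vecℤ n → Vecℤ n → Set
Separates α u v =
  (dot (rootVec α) u < + 0 × + 0 < dot (rootVec α) v) ⊎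
  (+ 0 < dot (rootVec α) u × dot (rootVec α) v < + 0)

StrongExchangeD : ∀ {n} → Subset± n → Set
StrongExchangeD {n} M =
  ∀ (p q : SignedIdx n) → M p ≡ true → M q ≡ true → p ≢ q →
  ∃ λ (α : RootD n) →
    Separates α (pt p) (pt q) × (reflect α (pt p) ∈M M) × (reflect α (pt q) ∈M M)

ν : ∀ {n} → Subset± n → SignedIdx n → Bool
ν M x = M x

-- The tropical (Boolean/Krasner) equation ⊕_i x_i ⊙ x_{-i} is satisfied by a
-- valuation w iff the number of i with w(x_i) ⊙ w(x_{-i}) nonzero is not exactly one.
boolToℕ : Bool → ℕ
boolToℕ true  = 1
boolToℕ false = 0

SatisfiesTropD : ∀ {n} → (SignedIdx n → Bool) → Set
SatisfiesTropD {n} w =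
  sumFinℕ (λ (i : Fin n) → boolToℕ (w (true , i) ∧ w (false , i))) ≢ 1

-- For a ≠ b the root p − q reflects p = ±e_a and q = ±e_b into each other, so only the
-- pairs {e_a, −e_a} can obstruct the strong exchange property. Such a pair is exchanged by
-- α = e_a + e_j, which sends ±e_a to ∓e_j, as soon as some j ≠ a also has ±e_j ∈ M.
-- Conversely, if a is the only such index, s_α(−e_a) = −s_α(e_a) forces s_α(e_a) = ±e_a,
-- which is impossible for a separating α because the a-th coordinate of s_α(e_a) is
-- 1 − α_a² = 0.
module Submission where

open import Defs
open import Data.Nat using (ℕ)
open import Function.Bundles using (_⇔_; mk⇔)

open import Data.Bool using (Bool; true; false; _∧_; not)
import Data.Bool as Bool
open import Data.Bool.Properties using (¬-not)
open import Data.Fin using (Fin; zero; suc; _≟_)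
open import Data.Fin.Properties using (any?; 0≢1+n; suc-injective)
open import Data.Integer using (ℤ; +_; -_; _+_; _-_; _*_; _<_; +<+; -<+)
open import Data.Integer.Properties
  using (*-identityʳ; *-zeroʳ; *-comm; *-assoc; +-identityˡ; +-identityʳ; +-inverseʳ; <-irrefl; neg-distribˡ-*)
open import Data.Integer.Solver using (module +-*-Solver)
import Data.Nat as ℕ
open import Data.Nat.Properties using (≤-trans; m≤n+m; 1+n≢0)
open import Data.Product using (∃; _×_; _,_)
import Data.Product as Product
open import Data.Sum using (inj₁; inj₂)
open import Function using (_∘_; id)
open import Relation.Nullary using (Dec; yes; no; ¬?; _×-dec_; contradiction)
open import Relation.Binary.PropositionalEquality

open +-*-Solver using (solve; _:+_; _:-_; _:*_; :-_; _:=_; con)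

sgn-sq : ∀ s → sgn s * sgn s ≡ + 1
sgn-sq true  = refl
sgn-sq false = refl

sgn-not : ∀ s → sgn (not s) ≡ - sgn s
sgn-not true  = refl
sgn-not false = refl

sgn-*-not : ∀ s → sgn s * sgn (not s) ≡ - + 1
sgn-*-not true  = refl
sgn-*-not false = refl

sgn≢0 : ∀ s → sgn s ≢ + 0
sgn≢0 true  ()
sgn≢0 false ()

neg-sgn≢0 : ∀ s → - sgn s ≢ + 0
neg-sgn≢0 true  ()
neg-sgn≢0 false ()

sgn-neg⇒not : ∀ {s' s} → sgn s' ≡ - sgn s → s' ≡ not s
sgn-neg⇒not {true}  {false} _ = refl
sgn-neg⇒not {false} {true}  _ = refl
sgn-neg⇒not {true}  {true}  ()
sgn-neg⇒not {false} {false} ()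

basis-diag : ∀ {n} (k : Fin n) → basis k k ≡ + 1
basis-diag k with k ≟ k
... | yes _  = refl
... | no k≢k = contradiction refl k≢k

basis-offdiag : ∀ {n} {i k : Fin n} → i ≢ k → basis i k ≡ + 0
basis-offdiag {i = i} {k} i≢k with i ≟ k
... | yes i≡k = contradiction i≡k i≢k
... | no _    = refl

pt-diag : ∀ {n} s (a : Fin n) → pt (s , a) a ≡ sgn s
pt-diag s a = trans (cong (sgn s *_) (basis-diag a)) (*-identityʳ (sgn s))

pt-offdiag : ∀ {n} s {a k : Fin n} → a ≢ k → pt (s , a) k ≡ + 0
pt-offdiag s a≢k = trans (cong (sgn s *_) (basis-offdiag a≢k)) (*-zeroʳ (sgn s))

pt-neg-injective : ∀ {n} {q : SignedIdx n} {s b} → (∀ k → pt q k ≡ - pt (s , b) k) → q ≡ (not s , b)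
pt-neg-injective {q = s' , b'} {s} {b} q≗-p with b' ≟ b
... | yes refl = cong (_, b) (sgn-neg⇒not (begin
      sgn s'        ≡⟨ sym (pt-diag s' b) ⟩
      pt (s' , b) b ≡⟨ q≗-p b ⟩
      - pt (s , b) b ≡⟨ cong -_ (pt-diag s b) ⟩
      - sgn s       ∎))
  where open ≡-Reasoning
... | no b'≢b = contradiction (trans (sym (cong -_ (pt-diag s b))) (trans (sym (q≗-p b)) (pt-offdiag s' b'≢b)))
                              (neg-sgn≢0 s)

sumFin-cong : ∀ {n} {f g : Fin n → ℤ} → (∀ m → f m ≡ g m) → sumFin f ≡ sumFin g
sumFin-cong {ℕ.zero}  f≗g = refl
sumFin-cong {ℕ.suc n} f≗g = cong₂ _+_ (f≗g zero) (sumFin-cong (f≗g ∘ suc))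

sumFin-0 : ∀ {n} → sumFin {n} (λ _ → + 0) ≡ + 0
sumFin-0 {ℕ.zero}  = refl
sumFin-0 {ℕ.suc n} = trans (+-identityˡ _) (sumFin-0 {n})

sumFin-*basis : ∀ {n} (g : Fin n → ℤ) k → sumFin (λ m → g m * basis k m) ≡ g k
sumFin-*basis {ℕ.suc n} g zero = begin
  g zero * + 1 + sumFin (λ m → g (suc m) * + 0) ≡⟨ cong₂ _+_ (*-identityʳ (g zero)) (sumFin-cong (*-zeroʳ ∘ g ∘ suc)) ⟩
  g zero + sumFin {n} (λ _ → + 0)               ≡⟨ cong (λ y → g zero + y) (sumFin-0 {n}) ⟩
  g zero + + 0                                  ≡⟨ +-identityʳ (g zero) ⟩
  g zero                                        ∎
  where open ≡-Reasoning
sumFin-*basis {ℕ.suc n} g (suc k) =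
  trans (cong (_+ sumFin (λ m → g (suc m) * basis k m)) (*-zeroʳ (g zero)))
        (trans (+-identityˡ _) (sumFin-*basis (g ∘ suc) k))

dot-pt : ∀ {n} (u : Vecℤ n) s k → dot u (pt (s , k)) ≡ sgn s * u k
dot-pt u s k =
  trans (sumFin-cong (λ m → sym (*-assoc (u m) (sgn s) (basis k m))))
        (trans (sumFin-*basis (λ m → u m * sgn s) k) (*-comm (u k) (sgn s)))

reflect-pt : ∀ {n} (α : RootD n) s a k →
  reflect α (pt (s , a)) k ≡ sgn s * basis a k - (sgn s * rootVec α a) * rootVec α k
reflect-pt α s a k = cong (λ d → sgn s * basis a k - d * rootVec α k) (dot-pt (rootVec α) s a)

reflect-pt-not : ∀ {n} (α : RootD n) s a k → reflect α (pt (not s , a)) k ≡ - reflect α (pt (s , a)) k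
reflect-pt-not α s a k = begin
  reflect α (pt (not s , a)) k                 ≡⟨ reflect-pt α (not s) a k ⟩
  sgn (not s) * x - (sgn (not s) * r) * c      ≡⟨ cong (λ σ → σ * x - (σ * r) * c) (sgn-not s) ⟩
  - sgn s * x - (- sgn s * r) * c              ≡⟨ solve 4 (λ σ x r c → :- σ :* x :- (:- σ :* r) :* c
                                                                      := :- (σ :* x :- (σ :* r) :* c))
                                                        refl (sgn s) x r c ⟩
  - (sgn s * x - (sgn s * r) * c)              ≡⟨ cong -_ (sym (reflect-pt α s a k)) ⟩
  - reflect α (pt (s , a)) k                   ∎
  where
  open ≡-Reasoning
  x = basis a k
  r = rootVec α a
  c = rootVec α k

rootVec-at-i : ∀ {n} σ τ {i j : Fin n} (i≢j : i ≢ j) → rootVec (root σ τ i j i≢j) i ≡ sgn σ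
rootVec-at-i σ τ {i} i≢j
  rewrite basis-diag i | basis-offdiag (i≢j ∘ sym) | *-identityʳ (sgn σ) | *-zeroʳ (sgn τ) = +-identityʳ (sgn σ)

rootVec-at-j : ∀ {n} σ τ {i j : Fin n} (i≢j : i ≢ j) → rootVec (root σ τ i j i≢j) j ≡ sgn τ
rootVec-at-j σ τ {j = j} i≢j
  rewrite basis-diag j | basis-offdiag i≢j | *-identityʳ (sgn τ) | *-zeroʳ (sgn σ) = +-identityˡ (sgn τ)

rootVec-elsewhere : ∀ {n} σ τ {i j k : Fin n} (i≢j : i ≢ j) → i ≢ k → j ≢ k → rootVec (root σ τ i j i≢j) k ≡ + 0
rootVec-elsewhere σ τ i≢j i≢k j≢k
  rewrite basis-offdiag i≢k | basis-offdiag j≢k | *-zeroʳ (sgn σ) | *-zeroʳ (sgn τ) = refl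

rootVec² : ∀ {n} (α : RootD n) k → rootVec α k ≢ + 0 → rootVec α k * rootVec α k ≡ + 1
rootVec² α@(root σ τ i j i≢j) k αk≢0 = square (i ≟ k) (j ≟ k)
  where
  square : Dec (i ≡ k) → Dec (j ≡ k) → rootVec α k * rootVec α k ≡ + 1
  square (yes refl) _          = trans (cong (λ x → x * x) (rootVec-at-i σ τ i≢j)) (sgn-sq σ)
  square (no _)     (yes refl) = trans (cong (λ x → x * x) (rootVec-at-j σ τ i≢j)) (sgn-sq τ)
  square (no i≢k)   (no j≢k)   = contradiction (rootVec-elsewhere σ τ i≢j i≢k j≢k) αk≢0

separates-by-sgn : ∀ {n} (α : RootD n) {u v} s →
  dot (rootVec α) u ≡ sgn s → dot (rootVec α) v ≡ - sgn s → Separates α u v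
separates-by-sgn α true  αu αv rewrite αu | αv = inj₂ (+<+ (ℕ.s≤s ℕ.z≤n) , -<+)
separates-by-sgn α false αu αv rewrite αu | αv = inj₁ (-<+ , +<+ (ℕ.s≤s ℕ.z≤n))

separates⇒dot≢0 : ∀ {n} (α : RootD n) {u v} → Separates α u v → dot (rootVec α) u ≢ + 0
separates⇒dot≢0 α (inj₁ (αu<0 , _)) αu≡0 = <-irrefl refl (subst (_< + 0) αu≡0 αu<0)
separates⇒dot≢0 α (inj₂ (0<αu , _)) αu≡0 = <-irrefl refl (subst (+ 0 <_) αu≡0 0<αu)

separated⇒reflect-diag≡0 : ∀ {n} (α : RootD n) {s a v} → Separates α (pt (s , a)) v → reflect α (pt (s , a)) a ≡ + 0
separated⇒reflect-diag≡0 α {s} {a} sep = begin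
  reflect α (pt (s , a)) a              ≡⟨ cong₂ (λ x d → x - d * r) (pt-diag s a) (dot-pt (rootVec α) s a) ⟩
  sgn s - sgn s * r * r                 ≡⟨ cong (λ y → sgn s - y) (*-assoc (sgn s) r r) ⟩
  sgn s - sgn s * (r * r)               ≡⟨ cong (λ y → sgn s - sgn s * y) (rootVec² α a r≢0) ⟩
  sgn s - sgn s * + 1                   ≡⟨ cong (λ y → sgn s - y) (*-identityʳ (sgn s)) ⟩
  sgn s - sgn s                         ≡⟨ +-inverseʳ (sgn s) ⟩
  + 0                                   ∎
  where
  open ≡-Reasoning
  r = rootVec α a
  r≢0 : r ≢ + 0
  r≢0 r≡0 = separates⇒dot≢0 α sep (trans (dot-pt (rootVec α) s a) (trans (cong (sgn s *_) r≡0) (*-zeroʳ (sgn s))))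

reflect-swaps : ∀ {n} (α : RootD n) {u v} → (∀ k → rootVec α k ≡ u k - v k) →
  dot (rootVec α) u ≡ + 1 → dot (rootVec α) v ≡ - + 1 →
  (∀ k → reflect α u k ≡ v k) × (∀ k → reflect α v k ≡ u k)
reflect-swaps α {u} {v} α≗u-v αu αv =
    (λ k → trans (cong₂ (λ d a → u k - d * a) αu (α≗u-v k))
                 (solve 2 (λ x y → x :- con (+ 1) :* (x :- y) := y) refl (u k) (v k)))
  , (λ k → trans (cong₂ (λ d a → v k - d * a) αv (α≗u-v k))
                 (solve 2 (λ x y → y :- con (- + 1) :* (x :- y) := x) refl (u k) (v k)))

count : ∀ {n} → (Fin n → Bool) → ℕ
count f = sumFinℕ (λ i → boolToℕ (f i))

count≢0⇒∃ : ∀ {n} (f : Fin n → Bool) → count f ≢ 0 → ∃ λ i → f i ≡ true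
count≢0⇒∃ {ℕ.zero}  f c≢0 = contradiction refl c≢0
count≢0⇒∃ {ℕ.suc n} f c≢0 with f zero in f0
... | true  = zero , f0
... | false = Product.map suc id (count≢0⇒∃ (f ∘ suc) c≢0)

all-false⇒count≡0 : ∀ {n} (f : Fin n → Bool) → (∀ i → f i ≡ false) → count f ≡ 0
all-false⇒count≡0 {ℕ.zero}  f _ = refl
all-false⇒count≡0 {ℕ.suc n} f f≗false rewrite f≗false zero = all-false⇒count≡0 (f ∘ suc) (f≗false ∘ suc)

true⇒1≤count : ∀ {n} (f : Fin n → Bool) {i} → f i ≡ true → 1 ℕ.≤ count f
true⇒1≤count f {zero}  fi rewrite fi = ℕ.s≤s ℕ.z≤n
true⇒1≤count f {suc i} fi = ≤-trans (true⇒1≤count (f ∘ suc) fi) (m≤n+m _ (boolToℕ (f zero)))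

distinct-trues⇒2≤count : ∀ {n} (f : Fin n → Bool) {i j} → i ≢ j → f i ≡ true → f j ≡ true → 2 ℕ.≤ count f
distinct-trues⇒2≤count f {zero}  {zero}  i≢j _  _  = contradiction refl i≢j
distinct-trues⇒2≤count f {zero}  {suc j} _   fi fj rewrite fi = ℕ.s≤s (true⇒1≤count (f ∘ suc) fj)
distinct-trues⇒2≤count f {suc i} {zero}  _   fi fj rewrite fj = ℕ.s≤s (true⇒1≤count (f ∘ suc) fi)
distinct-trues⇒2≤count f {suc i} {suc j} i≢j fi fj =
  ≤-trans (distinct-trues⇒2≤count (f ∘ suc) (i≢j ∘ cong suc) fi fj) (m≤n+m _ (boolToℕ (f zero)))

count≡1⇒unique : ∀ {n} (f : Fin n → Bool) {i j} → count f ≡ 1 → f i ≡ true → f j ≡ true → i ≡ j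
count≡1⇒unique f {i} {j} c≡1 fi fj with i ≟ j
... | yes i≡j = i≡j
... | no i≢j  = contradiction (subst (2 ℕ.≤_) c≡1 (distinct-trues⇒2≤count f i≢j fi fj)) λ { (ℕ.s≤s ()) }

unique⇒count≡1 : ∀ {n} (f : Fin n → Bool) {a} → f a ≡ true → (∀ j → f j ≡ true → j ≡ a) → count f ≡ 1
unique⇒count≡1 {ℕ.suc n} f {zero} fa uniq rewrite fa =
  cong ℕ.suc (all-false⇒count≡0 (f ∘ suc) (λ j → ¬-not (0≢1+n ∘ sym ∘ uniq (suc j))))
unique⇒count≡1 {ℕ.suc n} f {suc a} fa uniq rewrite ¬-not (0≢1+n ∘ uniq zero) =
  unique⇒count≡1 (f ∘ suc) fa (λ j fj → suc-injective (uniq (suc j) fj))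

count≢1⇒another : ∀ {n} (f : Fin n → Bool) {a} → count f ≢ 1 → f a ≡ true → ∃ λ j → j ≢ a × f j ≡ true
count≢1⇒another f {a} c≢1 fa with any? (λ j → ¬? (j ≟ a) ×-dec (f j Bool.≟ true))
... | yes another = another
... | no ¬another = contradiction (unique⇒count≡1 f fa unique) c≢1
  where
  unique : ∀ j → f j ≡ true → j ≡ a
  unique j fj with j ≟ a
  ... | yes j≡a = j≡a
  ... | no j≢a  = contradiction (j , j≢a , fj) ¬another

doubled : ∀ {n} → Subset± n → Fin n → Bool
doubled M i = M (true , i) ∧ M (false , i)

doubled-intro : ∀ {n} (M : Subset± n) {s i} → M (s , i) ≡ true → M (not s , i) ≡ true → doubled M i ≡ true
doubled-intro M {true}  p q rewrite p | q = refl
doubled-intro M {false} p q rewrite p | q = refl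

doubled⇒∈ : ∀ {n} (M : Subset± n) {i} → doubled M i ≡ true → ∀ s → M (s , i) ≡ true
doubled⇒∈ M {i} d true  with M (true , i) | M (false , i)
... | true | true = refl
doubled⇒∈ M {i} d false with M (true , i) | M (false , i)
... | true | true = refl

∈M-intro : ∀ {n} {M : Subset± n} {v} p → M p ≡ true → (∀ k → v k ≡ pt p k) → v ∈M M
∈M-intro p Mp v≗p = p , Mp , sym ∘ v≗p

Exchangeable : ∀ {n} → Subset± n → SignedIdx n → SignedIdx n → Set
Exchangeable M p q = ∃ λ α → Separates α (pt p) (pt q) × reflect α (pt p) ∈M M × reflect α (pt q) ∈M M

exchange-distinct : ∀ {n} {M : Subset± n} {s t a b} (a≢b : a ≢ b) →
  M (s , a) ≡ true → M (t , b) ≡ true → Exchangeable M (s , a) (t , b)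
exchange-distinct {s = s} {t} {a} {b} a≢b Mp Mq =
  α , separates-by-sgn α true αp αq , ∈M-intro (t , b) Mq reflect-p , ∈M-intro (s , a) Mp reflect-q
  where
  α = root s (not t) a b a≢b
  α≗p-q : ∀ k → rootVec α k ≡ pt (s , a) k - pt (t , b) k
  α≗p-q k = cong (λ y → pt (s , a) k + y)
                 (trans (cong (_* basis b k) (sgn-not t)) (sym (neg-distribˡ-* (sgn t) (basis b k))))
  αp : dot (rootVec α) (pt (s , a)) ≡ + 1
  αp = trans (dot-pt (rootVec α) s a) (trans (cong (sgn s *_) (rootVec-at-i s (not t) a≢b)) (sgn-sq s))
  αq : dot (rootVec α) (pt (t , b)) ≡ - + 1
  αq = trans (dot-pt (rootVec α) t b) (trans (cong (sgn t *_) (rootVec-at-j s (not t) a≢b)) (sgn-*-not t))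
  reflect-p = Product.proj₁ (reflect-swaps α α≗p-q αp αq)
  reflect-q = Product.proj₂ (reflect-swaps α α≗p-q αp αq)

exchange-across : ∀ {n} (M : Subset± n) {a j} (a≢j : a ≢ j) → doubled M j ≡ true →
  ∀ s → Exchangeable M (s , a) (not s , a)
exchange-across M {a} {j} a≢j dj s =
    α , separates-by-sgn α s (αpt s) (trans (αpt (not s)) (sgn-not s))
  , ∈M-intro (not s , j) (doubled⇒∈ M dj (not s)) (reflect-across s)
  , ∈M-intro (not (not s) , j) (doubled⇒∈ M dj (not (not s))) (reflect-across (not s))
  where
  α = root true true a j a≢j
  αpt : ∀ s' → dot (rootVec α) (pt (s' , a)) ≡ sgn s'
  αpt s' = trans (dot-pt (rootVec α) s' a)
                 (trans (cong (sgn s' *_) (rootVec-at-i true true a≢j)) (*-identityʳ (sgn s')))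
  reflect-across : ∀ s' k → reflect α (pt (s' , a)) k ≡ pt (not s' , j) k
  reflect-across s' k = begin
    reflect α (pt (s' , a)) k                                   ≡⟨ cong (λ d → pt (s' , a) k - d * rootVec α k) (αpt s') ⟩
    sgn s' * x - sgn s' * (+ 1 * x + + 1 * y)                   ≡⟨ solve 3 (λ σ x y → σ :* x :- σ :* (con (+ 1) :* x :+ con (+ 1) :* y)
                                                                                   := :- σ :* y)
                                                                           refl (sgn s') x y ⟩
    - sgn s' * y                                                ≡⟨ cong (_* y) (sym (sgn-not s')) ⟩
    pt (not s' , j) k                                           ∎
    where
    open ≡-Reasoning
    x = basis a k
    y = basis j k

strongExchange⇒trop : ∀ {n} (M : Subset± n) → StrongExchangeD M → SatisfiesTropD (ν M)
strongExchange⇒trop M exch count≡1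
  with count≢0⇒∃ (doubled M) (λ c≡0 → 1+n≢0 (trans (sym count≡1) c≡0))
... | a , da
  with exch (true , a) (false , a) (doubled⇒∈ M da true) (doubled⇒∈ M da false) (λ ())
... | α , sep , ((s , b) , Mp , p≗) , (q , Mq , q≗)
  with pt-neg-injective {q = q} {s} {b} (λ k → trans (q≗ k) (trans (reflect-pt-not α true a k) (cong -_ (sym (p≗ k)))))
... | refl
  with count≡1⇒unique (doubled M) count≡1 (doubled-intro M Mp Mq) da
... | refl =
  sgn≢0 s (trans (sym (pt-diag s a)) (trans (p≗ a) (separated⇒reflect-diag≡0 α {true} {a} {pt (false , a)} sep)))

trop⇒strongExchange : ∀ {n} (M : Subset± n) → SatisfiesTropD (ν M) → StrongExchangeD M
trop⇒strongExchange M trop (s , a) (t , b) Mp Mq p≢q with a ≟ b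
... | no a≢b = exchange-distinct a≢b Mp Mq
... | yes refl with ¬-not (λ t≡s → p≢q (cong (_, a) (sym t≡s)))
... | refl with count≢1⇒another (doubled M) trop (doubled-intro M Mp Mq)
... | j , j≢a , dj = exchange-across M (j≢a ∘ sym) dj s

lemma3p10 : (n : ℕ) (M : Subset± n) → StrongExchangeD M ⇔ SatisfiesTropD (ν M)
lemma3p10 n M = mk⇔ (strongExchange⇒trop M) (trop⇒strongExchange M)
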